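{- Let $\beta\ge3$ be an integer, let $(G=(A,B,E),\{A_i\},\{B_i\})$ be a Min-Rep instance and let $G'$ be the directed graph constructed from it as described in the context. If there is a shortcut set for $G'$ with hopbound $\beta$ and size $\gamma$, then there is a REP-cover of the Min-Rep instance of size at most $2\gamma$.
   Context: Min-Rep instance: an undirected bipartite graph $G=(A,B,E)$ with partitions $A=A_1\cup\dots\cup A_m$ and $B=B_1\cup\dots\cup B_m$ into groups, all of the same size. $(i,j)$ is a superedge if some edge joins $A_i$ and $B_j$. A REP-cover is a set $S\subseteq A\cup B$ such that for every superedge $(i,j)$ there are $x\in A_i\cap S$, $y\in B_j\cap S$ with $\{x,y\}\in E$. Construction of $G'=(V',E')$: add new vertices $a_i^1,a_i^2,b_i^1,b_i^2$ for $i\in[m]$, and for each $e=\{a,b\}\in E$ ($a\in A$, $b\in B$) new vertices $v_e^1,\dots,v_e^{\beta-3}$ (none if $\beta=3$); $V'$ is $A\cup B$ together with all these. Directed edges: for each $e=\{a,b\}$ the path $P_e$ consisting of $(a,v_e^1)$, $(v_e^i,v_e^{i+1})$ for $i\in[\beta-4]$, and $(v_e^{\beta-3},b)$ (if $\beta=3$, $P_e=\{(a,b)\}$); plus $(a_i^1,a_i^2)$ and $(b_i^2,b_i^1)$ for $i\in[m]$; plus $(a_i^2,x)$ for $x\in A_i$ and $(x,b_i^2)$ for $x\in B_i$. A shortcut set with hopbound $\beta$ for $G'$ is a set of directed edges $(x,y)$ with $y$ reachable from $x$ in $G'$ such that for every pair $x,y$ with $y$ reachable from $x$, the graph obtained by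 adding the set to $G'$ has an $x$–$y$ path with at most $\beta$ edges. -}

module Defs where

open import Data.Nat using (ℕ; zero; suc; _+_; _*_; _∸_; _≤_)
open import Data.Fin using (Fin; toℕ)
open import Data.Bool using (Bool; T)
open import Data.Product using (Σ; ∃; ∃-syntax; _×_; _,_)
open import Data.Sum using (_⊎_)
open import Data.List using (List; length)
open import Data.List.Membership.Propositional using (_∈_)
open import Relation.Binary.PropositionalEquality using (_≡_)

-- A Min-Rep instance with m groups on each side, every group of size s.
-- Vertex (i , p) of A is the p-th vertex of group A_i; similarly for B.
-- The bipartite edge set E is given by its characteristic function:
-- E i p j q = true  iff  {(i,p) ∈ A , (j,q) ∈ B} is an edge.
EdgeRel : ℕ → ℕ → Set
EdgeRel m s = Fin m → Fin s → Fin m → Fin s → Bool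

data AB (m s : ℕ) : Set where
  inA : Fin m → Fin s → AB m s
  inB : Fin m → Fin s → AB m s

module MinRep (m s : ℕ) (E : EdgeRel m s) where

  Superedge : Fin m → Fin m → Set
  Superedge i j = ∃[ p ] ∃[ q ] T (E i p j q)

  IsRepCover : List (AB m s) → Set
  IsRepCover S = ∀ i j → Superedge i j →
    ∃[ p ] ∃[ q ] (inA i p ∈ S × inB j q ∈ S × T (E i p j q))

data Walk {V : Set} (R : V → V → Set) : ℕ → V → V → Set where
  []  : ∀ {x} → Walk R zero x x
  _∷_ : ∀ {k x y z} → R x y → Walk R k y z → Walk R (suc k) x z

Reachable : {V : Set} → (V → V → Set) → V → V → Set
Reachable R x y = ∃[ k ] Walk R k x y

module Construction (β m s : ℕ) (E : EdgeRel m s) where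

  -- Vertex set V' of G'.
  -- mid i p j q e k  is the vertex v_e^{k+1} on the path P_e of the edge
  -- e = {(i,p),(j,q)}, for k ∈ {0, …, β-4}.
  data V' : Set where
    vA  : Fin m → Fin s → V'
    vB  : Fin m → Fin s → V'
    a¹ a² b¹ b² : Fin m → V'
    mid : (i : Fin m) (p : Fin s) (j : Fin m) (q : Fin s) →
          T (E i p j q) → Fin (β ∸ 3) → V'

  data Arc : V' → V' → Set where
    -- P_e when β = 3
    direct : ∀ {i p j q} → β ≡ 3 → T (E i p j q) → Arc (vA i p) (vB j q)
    first  : ∀ {i p j q} (e : T (E i p j q)) (k : Fin (β ∸ 3)) →
             toℕ k ≡ 0 → Arc (vA i p) (mid i p j q e k)
    step   : ∀ {i p j q} (e : T (E i p j q)) (k k′ : Fin (β ∸ 3)) →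
             suc (toℕ k) ≡ toℕ k′ → Arc (mid i p j q e k) (mid i p j q e k′)
    last   : ∀ {i p j q} (e : T (E i p j q)) (k : Fin (β ∸ 3)) →
             suc (toℕ k) ≡ β ∸ 3 → Arc (mid i p j q e k) (vB j q)
    a¹a²   : ∀ i → Arc (a¹ i) (a² i)
    b²b¹   : ∀ i → Arc (b² i) (b¹ i)
    a²A    : ∀ i p → Arc (a² i) (vA i p)
    Bb²    : ∀ i p → Arc (vB i p) (b² i)

  Augmented : List (V' × V') → V' → V' → Set
  Augmented H x y = Arc x y ⊎ (x , y) ∈ H

  IsShortcutSet : List (V' × V') → Set
  IsShortcutSet H =
    (∀ {x y} → (x , y) ∈ H → Reachable Arc x y) ×
    (∀ x y → Reachable Arc x y →
       ∃[ k ] (k ≤ β × Walk (Augmented H) k x y))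

-- Grade the vertices of G′ by level: a¹ᵢ, a²ᵢ, A, the interior of Pₑ, B, b²ⱼ, b¹ⱼ sit at
-- 0, 1, 2, 3…β−1, β, β+1, β+2, and every arc climbs exactly one level. Each shortcut is
-- charged at most two vertices, read off a path of G′ realising it: the ends of the first
-- edge e whose path Pₑ it enters, or, if it enters none, its end point in A and its start
-- point in B. For a superedge (i, j) the hopbound yields a walk from a¹ᵢ to b¹ⱼ climbing
-- β + 2 levels in at most β hops, so some shortcut climbs two levels or more. If it starts
-- below β and ends above 2, it enters some Pₑ with e between Aᵢ and Bⱼ. Otherwise it ends
-- at some a ∈ Aᵢ, and a later shortcut must again climb two levels: either it crosses as
-- before, or it runs from some b ∈ Bⱼ, reachable from a, to b¹ⱼ, whence {a, b} ∈ E.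

module Submission where

open import Defs
open import Data.Nat using (ℕ; _≤_; _*_)
open import Data.Product using (∃-syntax; _×_)
open import Data.List using (List; length)
open import Data.List.Relation.Unary.Unique.Propositional using (Unique)

open import Data.Nat using (zero; suc; _+_; _<_; _<?_; _≤?_; z≤n; s≤s)
open import Data.Nat.Properties
open import Data.Fin as Fin using (Fin; toℕ; fromℕ<)
open import Data.Fin.Properties using (toℕ<n; toℕ-fromℕ<)
open import Data.Bool using (T)
open import Data.Maybe using (Maybe; just; nothing)
open import Data.Product using (_,_; proj₂; ∃₂)
open import Data.Sum using (inj₁; inj₂)
open import Data.Unit using (⊤; tt)
open import Data.Empty using (⊥; ⊥-elim)
open import Data.List using ([]; _∷_; _++_; concat; deduplicate; fromMaybe)
open import Data.List.Properties using (length-++; length-deduplicate)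
open import Data.List.Membership.Propositional using (_∈_; mapWith∈)
open import Data.List.Membership.Propositional.Properties
  using (∈-++⁺ʳ; ∈-concat⁺′; ∈-deduplicate⁺)
open import Data.List.Relation.Binary.Subset.Propositional using (_⊆_)
open import Data.List.Relation.Unary.Any using (here; there)
open import Data.List.Relation.Unary.Any.Properties using (mapWith∈⁺)
open import Function using (_∘_)
open import Relation.Nullary using (yes; no)
open import Relation.Nullary.Decidable using (map′; _×-dec_)
open import Relation.Binary.Definitions using (DecidableEquality)
open import Relation.Binary.PropositionalEquality
import Data.List.Relation.Unary.Unique.DecPropositional.Properties as UniqueDec

m≤1+n⇒m+o≤n+1+o : ∀ {m n} o → m ≤ suc n → m + o ≤ n + suc o
m≤1+n⇒m+o≤n+1+o {n = n} o m≤1+n = ≤-trans (+-monoˡ-≤ o m≤1+n) (≤-reflexive (sym (+-suc n o)))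

length-concat-mapWith∈ : ∀ {A B : Set} {k} (xs : List A) (f : ∀ {x} → x ∈ xs → List B) →
  (∀ {x} (x∈xs : x ∈ xs) → length (f x∈xs) ≤ k) →
  length (concat (mapWith∈ xs f)) ≤ k * length xs
length-concat-mapWith∈ [] f bounded = z≤n
length-concat-mapWith∈ {k = k} (_ ∷ xs) f bounded = begin
  length (f (here refl) ++ concat (mapWith∈ xs (f ∘ there)))
    ≡⟨ length-++ (f (here refl)) ⟩
  length (f (here refl)) + length (concat (mapWith∈ xs (f ∘ there)))
    ≤⟨ +-mono-≤ (bounded (here refl))
                (length-concat-mapWith∈ xs (f ∘ there) (bounded ∘ there)) ⟩
  k + k * length xs
    ≡⟨ sym (*-suc k (length xs)) ⟩
  k * suc (length xs) ∎
  where open ≤-Reasoning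

length-fromMaybe : ∀ {A : Set} (mx : Maybe A) → length (fromMaybe mx) ≤ 1
length-fromMaybe (just _) = ≤-refl
length-fromMaybe nothing  = z≤n

_≟AB_ : ∀ {m s} → DecidableEquality (AB m s)
inA i p ≟AB inA i′ p′ =
  map′ (λ { (refl , refl) → refl }) (λ { refl → refl , refl }) (i Fin.≟ i′ ×-dec p Fin.≟ p′)
inA _ _ ≟AB inB _ _   = no λ ()
inB _ _ ≟AB inA _ _   = no λ ()
inB j q ≟AB inB j′ q′ =
  map′ (λ { (refl , refl) → refl }) (λ { refl → refl , refl }) (j Fin.≟ j′ ×-dec q Fin.≟ q′)

module _ {V : Set} {R : V → V → Set} where

  ε : ∀ {x} → Reachable R x x
  ε = 0 , []

  _◅_ : ∀ {x y z} → R x y → Reachable R y z → Reachable R x z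
  a ◅ (k , w) = suc k , a ∷ w

  _◅◅_ : ∀ {x y z} → Reachable R x y → Reachable R y z → Reachable R x z
  (_ , []) ◅◅ r = r
  (_ , a ∷ w) ◅◅ r = a ◅ ((_ , w) ◅◅ r)

  infixr 5 _◅_ _◅◅_

-- β is written 3 + t, so that the index type Fin (β ∸ 3) of the interior of Pₑ is Fin t.
module Reduction (t m s : ℕ) (E : EdgeRel m s) where
  open Construction (3 + t) m s E
  open MinRep m s E

  lvl : V' → ℕ
  lvl (a¹ _)               = 0
  lvl (a² _)               = 1
  lvl (vA _ _)             = 2
  lvl (mid _ _ _ _ _ k)    = 3 + toℕ k
  lvl (vB _ _)             = 3 + t
  lvl (b² _)               = 4 + t
  lvl (b¹ _)               = 5 + t

  lvl-arc : ∀ {x y} → Arc x y → lvl y ≡ suc (lvl x)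
  lvl-arc (direct 3+t≡3 _)      = 3+t≡3
  lvl-arc (first _ _ k≡0)       = cong (3 +_) k≡0
  lvl-arc (step _ _ _ 1+k≡k′)   = cong (3 +_) (sym 1+k≡k′)
  lvl-arc (last _ _ 1+k≡t)      = cong (3 +_) (sym 1+k≡t)
  lvl-arc (a¹a² _)              = refl
  lvl-arc (b²b¹ _)              = refl
  lvl-arc (a²A _ _)             = refl
  lvl-arc (Bb² _ _)             = refl

  lvl-mono : ∀ {n x y} → Walk Arc n x y → lvl x ≤ lvl y
  lvl-mono []      = ≤-refl
  lvl-mono (a ∷ w) = ≤-trans (<⇒≤ (≤-reflexive (sym (lvl-arc a)))) (lvl-mono w)

  lvl≡2⇒vA : ∀ x → lvl x ≡ 2 → ∃₂ λ i p → x ≡ vA i p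
  lvl≡2⇒vA (vA i p) _ = i , p , refl
  lvl≡2⇒vA (a¹ _) ()
  lvl≡2⇒vA (a² _) ()
  lvl≡2⇒vA (mid _ _ _ _ _ _) ()
  lvl≡2⇒vA (vB _ _) ()
  lvl≡2⇒vA (b² _) ()
  lvl≡2⇒vA (b¹ _) ()

  lvl≡β⇒vB : ∀ x → lvl x ≡ 3 + t → ∃₂ λ j q → x ≡ vB j q
  lvl≡β⇒vB (vB j q) _ = j , q , refl
  lvl≡β⇒vB (mid _ _ _ _ _ k) 3+k≡3+t = ⊥-elim (<-irrefl (+-cancelˡ-≡ 3 _ _ 3+k≡3+t) (toℕ<n k))
  lvl≡β⇒vB (a¹ _) ()
  lvl≡β⇒vB (a² _) ()
  lvl≡β⇒vB (vA _ _) ()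
  lvl≡β⇒vB (b² _) ()
  lvl≡β⇒vB (b¹ _) ()

  Downstream : Fin m → V' → Set
  Downstream i (a¹ i′)             = i′ ≡ i
  Downstream i (a² i′)             = i′ ≡ i
  Downstream i (vA i′ _)           = i′ ≡ i
  Downstream i (mid i′ _ _ _ _ _)  = i′ ≡ i
  Downstream i _                   = ⊤

  downstream : ∀ {i n x y} → Walk Arc n x y → Downstream i x → Downstream i y
  downstream []                     d = d
  downstream (direct _ _ ∷ w)       _ = downstream w tt
  downstream (first _ _ _ ∷ w)      d = downstream w d
  downstream (step _ _ _ _ ∷ w)     d = downstream w d
  downstream (last _ _ _ ∷ w)       _ = downstream w tt
  downstream (a¹a² _ ∷ w)           d = downstream w d
  downstream (a²A _ _ ∷ w)          d = downstream w d
  downstream (Bb² _ _ ∷ w)          _ = downstream w tt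
  downstream (b²b¹ _ ∷ w)           _ = downstream w tt

  Upstream : Fin m → V' → Set
  Upstream j (b¹ j′)              = j′ ≡ j
  Upstream j (b² j′)              = j′ ≡ j
  Upstream j (vB j′ _)            = j′ ≡ j
  Upstream j (mid _ _ j′ _ _ _)   = j′ ≡ j
  Upstream j _                    = ⊤

  upstream : ∀ {j n x y} → Walk Arc n x y → Upstream j y → Upstream j x
  upstream []                  u = u
  upstream (direct _ _ ∷ _)    _ = tt
  upstream (first _ _ _ ∷ _)   _ = tt
  upstream (step _ _ _ _ ∷ w)  u = upstream w u
  upstream (last _ _ _ ∷ w)    u = upstream w u
  upstream (a¹a² _ ∷ _)        _ = tt
  upstream (a²A _ _ ∷ _)       _ = tt
  upstream (Bb² _ _ ∷ w)       u = upstream w u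
  upstream (b²b¹ _ ∷ w)        u = upstream w u

  vB⇝vB⇒≡ : ∀ {n j q j′ q′} → Walk Arc n (vB j q) (vB j′ q′) → vB j q ≡ vB j′ q′
  vB⇝vB⇒≡ []                              = refl
  vB⇝vB⇒≡ (Bb² _ _ ∷ b²b¹ _ ∷ (() ∷ _))

  mid⇝vB⇒edge : ∀ {n i p j q j′ q′ e k} → Walk Arc n (mid i p j q e k) (vB j′ q′) →
    T (E i p j′ q′)
  mid⇝vB⇒edge (step _ _ _ _ ∷ w) = mid⇝vB⇒edge w
  mid⇝vB⇒edge {e = e} (last _ _ _ ∷ w) with vB⇝vB⇒≡ w
  ... | refl = e

  vA⇝vB⇒edge : ∀ {n i p j q} → Walk Arc n (vA i p) (vB j q) → T (E i p j q)
  vA⇝vB⇒edge (direct _ e ∷ w) with vB⇝vB⇒≡ w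
  ... | refl = e
  vA⇝vB⇒edge (first _ _ _ ∷ w) = mid⇝vB⇒edge w

  module _ {i p j q} (e : T (E i p j q)) where

    vA⇝mid : ∀ k (k<t : k < t) → Reachable Arc (vA i p) (mid i p j q e (fromℕ< k<t))
    vA⇝mid zero    k<t = first e _ (toℕ-fromℕ< k<t) ◅ ε
    vA⇝mid (suc k) k<t =
      vA⇝mid k (<⇒≤ k<t) ◅◅
      step e _ _ (trans (cong suc (toℕ-fromℕ< _)) (sym (toℕ-fromℕ< k<t))) ◅ ε

    edge-path : Reachable Arc (vA i p) (vB j q)
    edge-path = via t refl
      where
      via : ∀ t′ → t ≡ t′ → Reachable Arc (vA i p) (vB j q)
      via zero      t≡0    = direct (cong (3 +_) t≡0) e ◅ ε
      via (suc t′)  t≡1+t′ =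
        vA⇝mid t′ t′<t ◅◅ last e _ (trans (cong suc (toℕ-fromℕ< t′<t)) (sym t≡1+t′)) ◅ ε
        where t′<t = subst (t′ <_) (sym t≡1+t′) ≤-refl

    superedge-path : Reachable Arc (a¹ i) (b¹ j)
    superedge-path = a¹a² i ◅ a²A i p ◅ edge-path ◅◅ Bb² j q ◅ b²b¹ j ◅ ε

  traversed : ∀ {n x y} → Walk Arc n x y → Maybe (Fin m × Fin s × Fin m × Fin s)
  traversed []                                     = nothing
  traversed (direct {i} {p} {j} {q} _ _ ∷ _)       = just (i , p , j , q)
  traversed (first {i} {p} {j} {q} _ _ _ ∷ _)      = just (i , p , j , q)
  traversed (step {i} {p} {j} {q} _ _ _ _ ∷ _)     = just (i , p , j , q)
  traversed (last {i} {p} {j} {q} _ _ _ ∷ _)       = just (i , p , j , q)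
  traversed (a¹a² _ ∷ w)                           = traversed w
  traversed (a²A _ _ ∷ w)                          = traversed w
  traversed (Bb² _ _ ∷ w)                          = traversed w
  traversed (b²b¹ _ ∷ w)                           = traversed w

  asA asB : V' → Maybe (AB m s)
  asA (vA i p) = just (inA i p)
  asA _        = nothing
  asB (vB j q) = just (inB j q)
  asB _        = nothing

  representatives : Maybe (Fin m × Fin s × Fin m × Fin s) → V' → V' → List (AB m s)
  representatives (just (i , p , j , q)) _ _ = inA i p ∷ inB j q ∷ []
  representatives nothing                x y = fromMaybe (asB x) ++ fromMaybe (asA y)

  rep : ∀ {n x y} → Walk Arc n x y → List (AB m s)
  rep {x = x} {y} w = representatives (traversed w) x y

  length-rep : ∀ {n x y} (w : Walk Arc n x y) → length (rep w) ≤ 2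
  length-rep {x = x} {y} w with traversed w
  ... | just _  = ≤-refl
  ... | nothing = begin
    length (fromMaybe (asB x) ++ fromMaybe (asA y))
      ≡⟨ length-++ (fromMaybe (asB x)) ⟩
    length (fromMaybe (asB x)) + length (fromMaybe (asA y))
      ≤⟨ +-mono-≤ (length-fromMaybe (asB x)) (length-fromMaybe (asA y)) ⟩
    2 ∎
    where open ≤-Reasoning

  Represents : Fin m → Fin m → List (AB m s) → Set
  Represents i j S = ∃[ p ] ∃[ q ] (inA i p ∈ S × inB j q ∈ S × T (E i p j q))

  represents-mono : ∀ {i j S S′} → S ⊆ S′ → Represents i j S → Represents i j S′
  represents-mono S⊆S′ (p , q , a∈S , b∈S , e) = p , q , S⊆S′ a∈S , S⊆S′ b∈S , e

  no-walk-to-vA : ∀ {n x i p} → 3 ≤ lvl x → Walk Arc n x (vA i p) → ⊥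
  no-walk-to-vA 3≤x w = <-irrefl refl (≤-trans 3≤x (lvl-mono w))

  traversed-into-vA : ∀ {n x i p} (w : Walk Arc n x (vA i p)) → traversed w ≡ nothing
  traversed-into-vA []                 = refl
  traversed-into-vA (direct _ _ ∷ w)   = ⊥-elim (no-walk-to-vA (s≤s (s≤s (s≤s z≤n))) w)
  traversed-into-vA (first _ _ _ ∷ w)  = ⊥-elim (no-walk-to-vA (s≤s (s≤s (s≤s z≤n))) w)
  traversed-into-vA (step _ _ _ _ ∷ w) = ⊥-elim (no-walk-to-vA (s≤s (s≤s (s≤s z≤n))) w)
  traversed-into-vA (last _ _ _ ∷ w)   = ⊥-elim (no-walk-to-vA (s≤s (s≤s (s≤s z≤n))) w)
  traversed-into-vA (a¹a² _ ∷ w)       = traversed-into-vA w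
  traversed-into-vA (a²A _ _ ∷ w)      = traversed-into-vA w
  traversed-into-vA (Bb² _ _ ∷ w)      = traversed-into-vA w
  traversed-into-vA (b²b¹ _ ∷ w)       = traversed-into-vA w

  traversed-from-vB : ∀ {n j q y} (w : Walk Arc n (vB j q) y) → traversed w ≡ nothing
  traversed-from-vB []                              = refl
  traversed-from-vB (Bb² _ _ ∷ [])                  = refl
  traversed-from-vB (Bb² _ _ ∷ b²b¹ _ ∷ [])         = refl
  traversed-from-vB (Bb² _ _ ∷ b²b¹ _ ∷ (() ∷ _))

  rep-into-vA : ∀ {n x i p} (w : Walk Arc n x (vA i p)) → inA i p ∈ rep w
  rep-into-vA {x = x} w rewrite traversed-into-vA w = ∈-++⁺ʳ (fromMaybe (asB x)) (here refl)

  rep-from-vB : ∀ {n j q y} (w : Walk Arc n (vB j q) y) → inB j q ∈ rep w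
  rep-from-vB w rewrite traversed-from-vB w = here refl

  Traverses : Fin m → Fin m → ∀ {n x y} → Walk Arc n x y → Set
  Traverses i j w = ∃₂ λ p q → traversed w ≡ just (i , p , j , q) × T (E i p j q)

  traverses-edge : ∀ {i j i′ p j′ q} → i′ ≡ i → j′ ≡ j → T (E i′ p j′ q) →
    ∃₂ λ p′ q′ → just (i′ , p , j′ , q) ≡ just (i , p′ , j , q′) × T (E i p′ j q′)
  traverses-edge refl refl e = _ , _ , refl , e

  traverses : ∀ {i j n x y} → Downstream i x → Upstream j y →
    lvl x < 3 + t → 3 ≤ lvl y → lvl x < lvl y → (w : Walk Arc n x y) → Traverses i j w
  traverses _ _ _ _ x<y []                 = ⊥-elim (<-irrefl refl x<y)
  traverses d u _ _ _ (direct _ e ∷ w)     = traverses-edge d (upstream w u) e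
  traverses d u _ _ _ (first e _ _ ∷ w)    = traverses-edge d (upstream w u) e
  traverses d u _ _ _ (step e _ _ _ ∷ w)   = traverses-edge d (upstream w u) e
  traverses d u _ _ _ (last e _ _ ∷ w)     = traverses-edge d (upstream w u) e
  traverses d u _ 3≤y _ (a¹a² _ ∷ w)       = traverses d u (s≤s (s≤s z≤n)) 3≤y (<⇒≤ 3≤y) w
  traverses d u _ 3≤y _ (a²A _ _ ∷ w)      = traverses d u (s≤s (s≤s (s≤s z≤n))) 3≤y 3≤y w
  traverses _ _ x<β _ _ (Bb² _ _ ∷ _)      = ⊥-elim (<-irrefl refl x<β)
  traverses _ _ x<β _ _ (b²b¹ _ ∷ _)       = ⊥-elim (<-irrefl refl (<-trans (n<1+n _) x<β))

  rep-traversed : ∀ {i j n x y} (w : Walk Arc n x y) → Traverses i j w → Represents i j (rep w)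
  rep-traversed w (p , q , traversed≡ , e) rewrite traversed≡ = p , q , here refl , there (here refl) , e

  module Shortcuts (H : List (V' × V')) (witness : ∀ {x y} → (x , y) ∈ H → Reachable Arc x y) where

    flatten : ∀ {r x y} → Walk (Augmented H) r x y → Reachable Arc x y
    flatten []                 = ε
    flatten (inj₁ a ∷ W)       = a ◅ flatten W
    flatten (inj₂ xy∈H ∷ W)    = witness xy∈H ◅◅ flatten W

    -- The first hop of an augmented walk that climbs two levels or more; every hop before
    -- it climbs at most one, which gives the budget.
    record LongShortcut (x y : V') (r : ℕ) : Set where
      field
        u v      : V'
        shortcut : (u , v) ∈ H
        prefix   : Reachable Arc x u
        rest     : ℕ
        suffix   : Walk (Augmented H) rest v y
        budget   : lvl u + suc rest ≤ lvl x + r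
        skips    : 2 + lvl u ≤ lvl v

      u<x+r : lvl u < lvl x + r
      u<x+r = ≤-trans (s≤s (m≤m+n (lvl u) rest)) (subst (_≤ lvl x + r) (+-suc (lvl u) rest) budget)

    long-shortcut : ∀ {r x y} → Walk (Augmented H) r x y → lvl x + r < lvl y → LongShortcut x y r
    extend : ∀ {r x z y} → Reachable Arc x z → lvl z ≤ suc (lvl x) →
      Walk (Augmented H) r z y → lvl x + suc r < lvl y → LongShortcut x y (suc r)

    long-shortcut {x = x} [] x<x = ⊥-elim (<-irrefl (+-identityʳ (lvl x)) x<x)
    long-shortcut (inj₁ a ∷ W) short = extend (a ◅ ε) (≤-reflexive (lvl-arc a)) W short
    long-shortcut {x = x} (_∷_ {y = z} (inj₂ xz∈H) W) short with lvl z ≤? suc (lvl x)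
    ... | yes z≤1+x = extend (witness xz∈H) z≤1+x W short
    ... | no z≰1+x  = record
      { u = x ; v = z ; shortcut = xz∈H ; prefix = ε ; rest = _ ; suffix = W
      ; budget = ≤-refl ; skips = ≰⇒> z≰1+x }

    extend {r} x⇝z z≤1+x W short = record
      { u = u ; v = v ; shortcut = shortcut ; prefix = x⇝z ◅◅ prefix ; rest = rest ; suffix = suffix
      ; budget = ≤-trans budget (m≤1+n⇒m+o≤n+1+o r z≤1+x) ; skips = skips }
      where open LongShortcut (long-shortcut W (≤-trans (s≤s (m≤1+n⇒m+o≤n+1+o r z≤1+x)) short))

    shortcut-rep : ∀ {xy} → xy ∈ H → List (AB m s)
    shortcut-rep xy∈H = rep (proj₂ (witness xy∈H))

    cover : List (AB m s)
    cover = deduplicate _≟AB_ (concat (mapWith∈ H shortcut-rep))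

    rep⊆cover : ∀ {x y} (xy∈H : (x , y) ∈ H) → shortcut-rep xy∈H ⊆ cover
    rep⊆cover xy∈H a∈rep =
      ∈-deduplicate⁺ _≟AB_ (∈-concat⁺′ a∈rep (mapWith∈⁺ shortcut-rep (_ , xy∈H , refl)))

    length-cover : length cover ≤ 2 * length H
    length-cover = ≤-trans (length-deduplicate _≟AB_ (concat (mapWith∈ H shortcut-rep)))
      (length-concat-mapWith∈ H shortcut-rep λ xy∈H → length-rep (proj₂ (witness xy∈H)))

    crossing-shortcut : ∀ {i j u v} (uv∈H : (u , v) ∈ H) → Downstream i u → Upstream j v →
      lvl u < 3 + t → 3 ≤ lvl v → lvl u < lvl v → Represents i j cover
    crossing-shortcut uv∈H d up u<β 3≤v u<v =
      represents-mono (rep⊆cover uv∈H) (rep-traversed w (traverses d up u<β 3≤v u<v w))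
      where w = proj₂ (witness uv∈H)

    represents-from-vA : ∀ {i p j r} → inA i p ∈ cover → Walk (Augmented H) r (vA i p) (b¹ j) →
      2 + r < 5 + t → Represents i j cover
    represents-from-vA {i} {p} {j} {r} inA∈cover W bound = via (long-shortcut W bound)
      where
      via : LongShortcut (vA i p) (b¹ j) r → Represents i j cover
      via L@record { u = u ; v = v ; shortcut = uv∈H ; prefix = vA⇝u ; suffix = W′ ; skips = skips }
        with lvl u <? 3 + t
      ... | yes u<β =
        crossing-shortcut uv∈H (downstream (proj₂ (a¹a² i ◅ a²A i p ◅ vA⇝u)) refl)
          (upstream (proj₂ (flatten W′)) refl) u<β 3≤v (≤-trans (n≤1+n _) skips)
        where
        3≤v : 3 ≤ lvl v
        3≤v = ≤-trans (+-monoʳ-≤ 2 (≤-trans (n≤1+n 1) (lvl-mono (proj₂ vA⇝u)))) skips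
      ... | no u≮β with lvl≡β⇒vB u (≤-antisym u≤β (≮⇒≥ u≮β))
        where u≤β = ≤-pred (≤-pred (≤-trans (s≤s (LongShortcut.u<x+r L)) bound))
      ... | j′ , q , refl with upstream {j = j} (proj₂ (witness uv∈H ◅◅ flatten W′)) refl
      ... | refl = p , q , inA∈cover , rep⊆cover uv∈H (rep-from-vB (proj₂ (witness uv∈H))) ,
                   vA⇝vB⇒edge (proj₂ vA⇝u)

    represents-from-a¹ : ∀ {i j r} → Walk (Augmented H) r (a¹ i) (b¹ j) → r ≤ 3 + t →
      Represents i j cover
    represents-from-a¹ {i} {j} {r} W r≤β = via (long-shortcut W (s≤s (m≤n⇒m≤1+n r≤β)))
      where
      via : LongShortcut (a¹ i) (b¹ j) r → Represents i j cover
      via L@record { u = u ; v = v ; shortcut = uv∈H ; prefix = a¹⇝u ; suffix = W′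
                   ; budget = budget ; skips = skips }
        with 3 ≤? lvl v
      ... | yes 3≤v =
        crossing-shortcut uv∈H (downstream (proj₂ a¹⇝u) refl) (upstream (proj₂ (flatten W′)) refl)
          (≤-trans (LongShortcut.u<x+r L) r≤β) 3≤v (≤-trans (n≤1+n _) skips)
      ... | no 3≰v with lvl≡2⇒vA v (≤-antisym (≤-pred (≰⇒> 3≰v)) (≤-trans (m≤m+n 2 (lvl u)) skips))
      ... | i′ , p , refl with downstream {i = i} (proj₂ (a¹⇝u ◅◅ witness uv∈H)) refl
      ... | refl = represents-from-vA (rep⊆cover uv∈H (rep-into-vA (proj₂ (witness uv∈H)))) W′
                     (s≤s (s≤s (m+n≤o⇒n≤o (lvl u) (≤-trans budget r≤β))))

lemma53 : (β m s : ℕ) (E : EdgeRel m s) → 3 ≤ β →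
    (H : List (Construction.V' β m s E × Construction.V' β m s E)) →
    Unique H → Construction.IsShortcutSet β m s E H →
    ∃[ S ] (Unique S × length S ≤ 2 * length H × MinRep.IsRepCover m s E S)
lemma53 _ m s E (s≤s (s≤s (s≤s {n = t} _))) H _ (witness , hopbound) =
  cover , UniqueDec.deduplicate-! _≟AB_ _ , length-cover , rep-cover
  where
  open Reduction t m s E
  open Shortcuts H witness
  rep-cover : MinRep.IsRepCover m s E cover
  rep-cover i j (p , q , e) with hopbound _ _ (superedge-path e)
  ... | r , r≤β , W = represents-from-a¹ W r≤β
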